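{- Let $n$ be an even positive integer, $b$ a positive integer with $n-2b$ a positive (even) integer, and $\beta$ a non-negative integer. If $2^\beta$ divides $b(n-b)$, then there exists a $(2^\beta-1)$-IMOFS$(n;n-2b)$.
   Context: For positive even integers $s<n$, an incomplete frequency square of type $(n;s)$ is an $n\times n$ array indexed by $\{1,\dots,n\}^2$ whose cells in $\{1,\dots,s\}\times\{1,\dots,s\}$ are empty, whose other cells contain $0$ or $1$, and in which every row and every column contains equally many $0$'s and $1$'s. Two such arrays are orthogonal if, when superimposed (on the non-empty cells), each of the ordered pairs $(0,0),(0,1),(1,0),(1,1)$ occurs the same number of times. A $k$-IMOFS$(n;s)$ is a set of $k$ pairwise orthogonal incomplete frequency squares of type $(n;s)$. -}

module Defs where

open import Data.Nat using (ℕ; zero; suc; _+_; _<_; _∸_; _*_; _^_)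
open import Data.Bool using (Bool; true; false; _∧_; if_then_else_)
open import Data.Maybe using (Maybe; just; nothing)
open import Data.Fin using (Fin; toℕ)
import Data.Fin as F
open import Data.Empty using (⊥)
open import Data.Product using (_×_)
open import Relation.Nullary using (¬_)
open import Relation.Binary.PropositionalEquality using (_≡_; _≢_)

sumF : ∀ {m} → (Fin m → ℕ) → ℕ
sumF {zero}  f = 0
sumF {suc m} f = f F.zero + sumF (λ x → f (F.suc x))

count : ∀ {m} → (Fin m → Bool) → ℕ
count p = sumF (λ x → if p x then 1 else 0)

has : Maybe Bool → Bool → Bool
has nothing      _     = false
has (just true)  true  = true
has (just false) false = true
has (just _)     _     = false

-- an n × n array whose cells are empty (nothing) or contain 0 (just false) / 1 (just true);
-- rows/columns {1..n} are represented by Fin n = {0..n-1}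
Array : ℕ → Set
Array n = Fin n → Fin n → Maybe Bool

-- cell (i,j) lies in {1..s}×{1..s}  (0-indexed: both indices < s)
InHole : ∀ {n} → ℕ → Fin n → Fin n → Set
InHole s i j = (toℕ i < s) × (toℕ j < s)

record IsIFS (n s : ℕ) (A : Array n) : Set where
  field
    hole-empty   : ∀ i j → InHole s i j → A i j ≡ nothing
    filled       : ∀ i j → ¬ InHole s i j → A i j ≢ nothing
    row-balanced : ∀ i → count (λ j → has (A i j) false) ≡ count (λ j → has (A i j) true)
    col-balanced : ∀ j → count (λ i → has (A i j) false) ≡ count (λ i → has (A i j) true)

pairCount : ∀ {n} → Array n → Array n → Bool → Bool → ℕ
pairCount A B a b = sumF (λ i → count (λ j → has (A i j) a ∧ has (B i j) b))

Orthogonal : ∀ {n} → Array n → Array n → Set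
Orthogonal A B = ∀ a b c d → pairCount A B a b ≡ pairCount A B c d

IMOFS : ℕ → ℕ → ℕ → Set
IMOFS k n s = Data.Product.Σ (Fin k → Array n) λ S →
  (∀ x → IsIFS n s (S x)) × (∀ x y → x ≢ y → Orthogonal (S x) (S y))

-- Write n = 2(r + b), so the hole has side 2r. Replace every cell (I , J) of an
-- (r + b) × (r + b) grid with hole r × r by the 2 × 2 frequency square
-- [[v , ¬v] , [¬v , v]], where v = v(I , J) is a bit. Whatever the bits, rows and columns
-- are balanced, and two such arrays with bits v and w are orthogonal as soon as v ≠ w on
-- exactly half of the b(n − b) cells outside the hole. Number those cells 0, 1, … and
-- let the bit of cell k in the x-th array be the Walsh character χₓ(k), the parity of the
-- bitwise AND of x and k on the lowest β bits. For x ≠ y below 2^β the characters χₓ and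
-- χ_y differ on exactly half of every range [0, m 2^β), which is where 2^β ∣ b(n − b)
-- enters; the characters x = 0, …, 2^β − 2 give the 2^β − 1 squares.
module Submission where

open import Defs
open import Data.Bool using (Bool; true; false; not; _∧_; _xor_; if_then_else_; T)
open import Data.Bool.Properties
  using (not-involutive; not-distribˡ-xor; not-distribʳ-xor; T-∧; T-≡)
  renaming (_≟_ to _≟ᵇ_)
open import Data.Fin using (Fin; toℕ)
import Data.Fin as Fin
open import Data.Fin.Properties using (toℕ<n; toℕ-injective)
open import Data.Maybe using (Maybe; just; nothing)
open import Data.Nat using (ℕ; zero; suc; _+_; _*_; _∸_; _^_; _<_; _≤_; _<ᵇ_; ⌊_/2⌋; s≤s; z≤n)
open import Data.Nat.Properties
open import Data.Nat.Divisibility using (_∣_; divides)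
open import Data.Nat.Tactic.RingSolver using (solve-∀)
open import Data.Product using (_×_; _,_)
import Data.Product as Product
open import Function using (_∘_; Equivalence)
open import Relation.Nullary using (yes; no; contradiction)
open import Relation.Binary.PropositionalEquality

ind : Bool → ℕ
ind b = if b then 1 else 0

ind-not+ind : ∀ b → ind (not b) + ind b ≡ 1
ind-not+ind false = refl
ind-not+ind true  = refl

sumTo : ℕ → (ℕ → ℕ) → ℕ
sumTo zero    f = 0
sumTo (suc n) f = f 0 + sumTo n (f ∘ suc)

countTo : ℕ → (ℕ → Bool) → ℕ
countTo n p = sumTo n (ind ∘ p)

sumF-cong : ∀ {n} {f g : Fin n → ℕ} → (∀ i → f i ≡ g i) → sumF f ≡ sumF g
sumF-cong {zero}  f≗g = refl
sumF-cong {suc n} f≗g = cong₂ _+_ (f≗g Fin.zero) (sumF-cong (f≗g ∘ Fin.suc))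

sumF-toℕ : ∀ n (f : ℕ → ℕ) → sumF {n} (f ∘ toℕ) ≡ sumTo n f
sumF-toℕ zero    f = refl
sumF-toℕ (suc n) f = cong (f 0 +_) (sumF-toℕ n (f ∘ suc))

sum-cong< : ∀ n {f g : ℕ → ℕ} → (∀ k → k < n → f k ≡ g k) → sumTo n f ≡ sumTo n g
sum-cong< zero    f≗g = refl
sum-cong< (suc n) f≗g =
  cong₂ _+_ (f≗g 0 (s≤s z≤n)) (sum-cong< n (λ k k<n → f≗g (suc k) (s≤s k<n)))

sum-cong : ∀ n {f g : ℕ → ℕ} → (∀ k → f k ≡ g k) → sumTo n f ≡ sumTo n g
sum-cong n f≗g = sum-cong< n (λ k _ → f≗g k)

sum-zero : ∀ n → sumTo n (λ _ → 0) ≡ 0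
sum-zero zero    = refl
sum-zero (suc n) = sum-zero n

sum-distrib-+ : ∀ n (f g : ℕ → ℕ) → sumTo n (λ k → f k + g k) ≡ sumTo n f + sumTo n g
sum-distrib-+ zero    f g = refl
sum-distrib-+ (suc n) f g = begin
  (f 0 + g 0) + sumTo n (λ k → f (suc k) + g (suc k))
    ≡⟨ cong (f 0 + g 0 +_) (sum-distrib-+ n (f ∘ suc) (g ∘ suc)) ⟩
  (f 0 + g 0) + (sumTo n (f ∘ suc) + sumTo n (g ∘ suc))
    ≡⟨ +-+-interchange (f 0) (g 0) _ _ ⟩
  (f 0 + sumTo n (f ∘ suc)) + (g 0 + sumTo n (g ∘ suc)) ∎
  where
  open ≡-Reasoning
  +-+-interchange : ∀ a b c d → (a + b) + (c + d) ≡ (a + c) + (b + d)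
  +-+-interchange = solve-∀

sum-++ : ∀ m n (f : ℕ → ℕ) → sumTo (m + n) f ≡ sumTo m f + sumTo n (f ∘ (m +_))
sum-++ zero    n f = refl
sum-++ (suc m) n f =
  trans (cong (f 0 +_) (sum-++ m n (f ∘ suc))) (sym (+-assoc (f 0) _ _))

sum-blocks : ∀ m n (f : ℕ → ℕ) → sumTo (m * n) f ≡ sumTo m (λ I → sumTo n (λ k → f (I * n + k)))
sum-blocks zero    n f = refl
sum-blocks (suc m) n f = trans (sum-++ n (m * n) f) (cong (sumTo n f +_) (begin
  sumTo (m * n) (f ∘ (n +_))
    ≡⟨ sum-blocks m n (f ∘ (n +_)) ⟩
  sumTo m (λ I → sumTo n (λ k → f (n + (I * n + k))))
    ≡⟨ sum-cong m (λ I → sum-cong n (λ k → cong f (sym (+-assoc n (I * n) k)))) ⟩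
  sumTo m (λ I → sumTo n (λ k → f (suc I * n + k))) ∎))
  where open ≡-Reasoning

odd : ℕ → Bool
odd 0             = false
odd 1             = true
odd (suc (suc n)) = odd n

ind-odd+⌊n/2⌋*2≡n : ∀ n → ind (odd n) + ⌊ n /2⌋ * 2 ≡ n
ind-odd+⌊n/2⌋*2≡n 0             = refl
ind-odd+⌊n/2⌋*2≡n 1             = refl
ind-odd+⌊n/2⌋*2≡n (suc (suc n)) =
  trans (+-suc _ _) (cong suc (trans (+-suc _ _) (cong suc (ind-odd+⌊n/2⌋*2≡n n))))

odd-⌊/2⌋-injective : ∀ {m n} → odd m ≡ odd n → ⌊ m /2⌋ ≡ ⌊ n /2⌋ → m ≡ n
odd-⌊/2⌋-injective {m} {n} o≡ h≡ = begin
  m                          ≡⟨ sym (ind-odd+⌊n/2⌋*2≡n m) ⟩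
  ind (odd m) + ⌊ m /2⌋ * 2  ≡⟨ cong₂ (λ o h → ind o + h * 2) o≡ h≡ ⟩
  ind (odd n) + ⌊ n /2⌋ * 2  ≡⟨ ind-odd+⌊n/2⌋*2≡n n ⟩
  n                          ∎
  where open ≡-Reasoning

m<n*2⇒⌊m/2⌋<n : ∀ m n → m < n * 2 → ⌊ m /2⌋ < n
m<n*2⇒⌊m/2⌋<n 0             (suc n) _               = s≤s z≤n
m<n*2⇒⌊m/2⌋<n 1             (suc n) _               = s≤s z≤n
m<n*2⇒⌊m/2⌋<n (suc (suc m)) (suc n) (s≤s (s≤s m<)) = s≤s (m<n*2⇒⌊m/2⌋<n m n m<)

⌊m/2⌋<n⇒m<n*2 : ∀ m n → ⌊ m /2⌋ < n → m < n * 2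
⌊m/2⌋<n⇒m<n*2 0             (suc n) _          = s≤s z≤n
⌊m/2⌋<n⇒m<n*2 1             (suc n) _          = s≤s (s≤s z≤n)
⌊m/2⌋<n⇒m<n*2 (suc (suc m)) (suc n) (s≤s m<) = s≤s (s≤s (⌊m/2⌋<n⇒m<n*2 m n m<))

sum-pairs : ∀ n (F : ℕ → Bool → ℕ) →
            sumTo (n * 2) (λ k → F ⌊ k /2⌋ (odd k)) ≡ sumTo n (λ K → F K false + F K true)
sum-pairs zero    F = refl
sum-pairs (suc n) F =
  trans (cong (λ s → F 0 false + (F 0 true + s)) (sum-pairs n (F ∘ suc)))
        (sym (+-assoc (F 0 false) _ _))

Balanced : ℕ → (ℕ → Bool) → Set
Balanced n p = countTo n p ≡ countTo n (not ∘ p)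

Balanced-cong : ∀ n {p q} → (∀ k → p k ≡ q k) → Balanced n p → Balanced n q
Balanced-cong n p≗q bal =
  trans (sum-cong n (cong ind ∘ sym ∘ p≗q))
        (trans bal (sum-cong n (cong (ind ∘ not) ∘ p≗q)))

count-double : ∀ n p → countTo (n * 2) (p ∘ ⌊_/2⌋) ≡ countTo n p + countTo n p
count-double n p = trans (sum-pairs n (λ K _ → ind (p K))) (sum-distrib-+ n (ind ∘ p) (ind ∘ p))

Balanced-double : ∀ n p → Balanced n p → Balanced (n * 2) (p ∘ ⌊_/2⌋)
Balanced-double n p bal =
  trans (count-double n p) (trans (cong₂ _+_ bal bal) (sym (count-double n (not ∘ p))))

Balanced-alternating : ∀ n (F : ℕ → Bool → Bool) → (∀ K → F K false ≡ not (F K true)) →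
                       Balanced (n * 2) (λ k → F ⌊ k /2⌋ (odd k))
Balanced-alternating n F alt =
  trans (sum-pairs n (λ K p → ind (F K p)))
        (trans (sum-cong n pair-count) (sym (sum-pairs n (λ K p → ind (not (F K p))))))
  where
  pair-count : ∀ K → ind (F K false) + ind (F K true) ≡ ind (not (F K false)) + ind (not (F K true))
  pair-count K rewrite alt K = trans (ind-not+ind (F K true)) (sym (ind-not+ind (not (F K true))))

χ : ℕ → ℕ → ℕ → Bool
χ zero    x k = false
χ (suc β) x k = (odd x ∧ odd k) xor χ β ⌊ x /2⌋ ⌊ k /2⌋

xor-cancelˡ : ∀ c a b → (c xor a) xor (c xor b) ≡ a xor b
xor-cancelˡ false a     b = refl
xor-cancelˡ true  true  b = refl
xor-cancelˡ true  false b = not-involutive b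

xor-alternates : ∀ {o o′} → o ≢ o′ → ∀ a b →
                 ((o ∧ false) xor a) xor ((o′ ∧ false) xor b) ≡
                 not (((o ∧ true) xor a) xor ((o′ ∧ true) xor b))
xor-alternates {false} {false} o≢o′ a b = contradiction refl o≢o′
xor-alternates {true}  {true}  o≢o′ a b = contradiction refl o≢o′
xor-alternates {false} {true}  _    a b =
  sym (trans (not-distribʳ-xor a (not b)) (cong (a xor_) (not-involutive b)))
xor-alternates {true}  {false} _    a b =
  sym (trans (not-distribˡ-xor (not a) b) (cong (_xor b) (not-involutive a)))

walsh-balanced : ∀ β m {x y} → x < 2 ^ β → y < 2 ^ β → x ≢ y →
                 Balanced (m * 2 ^ β) (λ k → χ β x k xor χ β y k)
walsh-balanced zero    m x<1 y<1 x≢y = contradiction (trans (n<1⇒n≡0 x<1) (sym (n<1⇒n≡0 y<1))) x≢y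
walsh-balanced (suc β) m {x} {y} x< y< x≢y =
  subst (λ n → Balanced n (λ k → χ (suc β) x k xor χ (suc β) y k)) (sym length≡) balanced
  where
  length≡ : m * 2 ^ suc β ≡ m * 2 ^ β * 2
  length≡ = trans (cong (m *_) (*-comm 2 (2 ^ β))) (sym (*-assoc m (2 ^ β) 2))
  halve : ∀ {z} → z < 2 ^ suc β → ⌊ z /2⌋ < 2 ^ β
  halve {z} z< = m<n*2⇒⌊m/2⌋<n z (2 ^ β) (subst (z <_) (*-comm 2 (2 ^ β)) z<)
  balanced : Balanced (m * 2 ^ β * 2) (λ k → χ (suc β) x k xor χ (suc β) y k)
  balanced with odd x ≟ᵇ odd y
  ... | yes ox≡oy =
    Balanced-cong (m * 2 ^ β * 2) same-parity
      (Balanced-double (m * 2 ^ β) halves (walsh-balanced β m (halve x<) (halve y<)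
                                       (x≢y ∘ odd-⌊/2⌋-injective ox≡oy)))
    where
    halves : ℕ → Bool
    halves K = χ β ⌊ x /2⌋ K xor χ β ⌊ y /2⌋ K
    same-parity : ∀ k → halves ⌊ k /2⌋ ≡ χ (suc β) x k xor χ (suc β) y k
    same-parity k rewrite ox≡oy = sym (xor-cancelˡ (odd y ∧ odd k) _ _)
  ... | no ox≢oy =
    Balanced-alternating (m * 2 ^ β)
      (λ K p → ((odd x ∧ p) xor χ β ⌊ x /2⌋ K) xor ((odd y ∧ p) xor χ β ⌊ y /2⌋ K))
      (λ K → xor-alternates ox≢oy (χ β ⌊ x /2⌋ K) (χ β ⌊ y /2⌋ K))

hole : ℕ → ℕ → ℕ → Bool
hole r I J = (I <ᵇ r) ∧ (J <ᵇ r)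

<ᵇ-true : ∀ {m n} → m < n → (m <ᵇ n) ≡ true
<ᵇ-true = Equivalence.to T-≡ ∘ <⇒<ᵇ

m+n<ᵇm≡false : ∀ m n → (m + n <ᵇ m) ≡ false
m+n<ᵇm≡false zero    n = refl
m+n<ᵇm≡false (suc m) n = m+n<ᵇm≡false m n

hole-complete : ∀ {r I J} → I < r → J < r → T (hole r I J)
hole-complete I<r J<r = Equivalence.from T-∧ (<⇒<ᵇ I<r , <⇒<ᵇ J<r)

hole-sound : ∀ {r I J} → T (hole r I J) → I < r × J < r
hole-sound {r} {I} {J} inHole = Product.map (<ᵇ⇒< I r) (<ᵇ⇒< J r) (Equivalence.to T-∧ inHole)

entry : Bool → Bool → Bool → Bool → Maybe Bool
entry h p₁ p₂ v = if h then nothing else just (p₁ xor (p₂ xor v))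

entry-in-hole : ∀ {h} p₁ p₂ v → T h → entry h p₁ p₂ v ≡ nothing
entry-in-hole {true} _ _ _ _ = refl

entry≡nothing⇒hole : ∀ h p₁ p₂ v → entry h p₁ p₂ v ≡ nothing → T h
entry≡nothing⇒hole true  _ _ _ _  = _
entry≡nothing⇒hole false _ _ _ ()

entry-row-balanced : ∀ h p v →
  ind (has (entry h p false v) false) + ind (has (entry h p true v) false) ≡
  ind (has (entry h p false v) true)  + ind (has (entry h p true v) true)
entry-row-balanced true  p     v     = refl
entry-row-balanced false false false = refl
entry-row-balanced false false true  = refl
entry-row-balanced false true  false = refl
entry-row-balanced false true  true  = refl

entry-col-balanced : ∀ h p v →
  ind (has (entry h false p v) false) + ind (has (entry h true p v) false) ≡
  ind (has (entry h false p v) true)  + ind (has (entry h true p v) true)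
entry-col-balanced true  p     v     = refl
entry-col-balanced false false false = refl
entry-col-balanced false false true  = refl
entry-col-balanced false true  false = refl
entry-col-balanced false true  true  = refl

-- Superimposing the blocks of v and w shows (a , c) twice if v xor w = a xor c, else never.
entry-superimposed : ∀ h v w a c →
  let Q p₁ p₂ = ind (has (entry h p₁ p₂ v) a ∧ has (entry h p₁ p₂ w) c)
      e       = ind (not h ∧ (not (a xor c) xor (v xor w)))
  in (Q false false + Q false true) + (Q true false + Q true true) ≡ e + e
entry-superimposed true  v     w     a     c     = refl
entry-superimposed false false false false false = refl
entry-superimposed false false false false true  = refl
entry-superimposed false false false true  false = refl
entry-superimposed false false false true  true  = refl
entry-superimposed false false true  false false = refl
entry-superimposed false false true  false true  = refl
entry-superimposed false false true  true  false = refl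
entry-superimposed false false true  true  true  = refl
entry-superimposed false true  false false false = refl
entry-superimposed false true  false false true  = refl
entry-superimposed false true  false true  false = refl
entry-superimposed false true  false true  true  = refl
entry-superimposed false true  true  false false = refl
entry-superimposed false true  true  false true  = refl
entry-superimposed false true  true  true  false = refl
entry-superimposed false true  true  true  true  = refl

cell : ℕ → (ℕ → ℕ → Bool) → ℕ → ℕ → Maybe Bool
cell r V i j = entry (hole r ⌊ i /2⌋ ⌊ j /2⌋) (odd i) (odd j) (V ⌊ i /2⌋ ⌊ j /2⌋)

blowup : ∀ {n} → ℕ → (ℕ → ℕ → Bool) → Array n
blowup r V i j = cell r V (toℕ i) (toℕ j)

count-by-pairs : ∀ n (F G : ℕ → Bool → Bool) →
  (∀ K → ind (F K false) + ind (F K true) ≡ ind (G K false) + ind (G K true)) →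
  count {n * 2} (λ j → F ⌊ toℕ j /2⌋ (odd (toℕ j))) ≡
  count {n * 2} (λ j → G ⌊ toℕ j /2⌋ (odd (toℕ j)))
count-by-pairs n F G pairs≡ = begin
  count {n * 2} (λ j → F ⌊ toℕ j /2⌋ (odd (toℕ j)))
    ≡⟨ sumF-toℕ (n * 2) (λ k → ind (F ⌊ k /2⌋ (odd k))) ⟩
  countTo (n * 2) (λ k → F ⌊ k /2⌋ (odd k))
    ≡⟨ sum-pairs n (λ K p → ind (F K p)) ⟩
  sumTo n (λ K → ind (F K false) + ind (F K true))
    ≡⟨ sum-cong n pairs≡ ⟩
  sumTo n (λ K → ind (G K false) + ind (G K true))
    ≡⟨ sym (sum-pairs n (λ K p → ind (G K p))) ⟩
  countTo (n * 2) (λ k → G ⌊ k /2⌋ (odd k))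
    ≡⟨ sym (sumF-toℕ (n * 2) (λ k → ind (G ⌊ k /2⌋ (odd k)))) ⟩
  count {n * 2} (λ j → G ⌊ toℕ j /2⌋ (odd (toℕ j))) ∎
  where open ≡-Reasoning

blowup-isIFS : ∀ q r V → IsIFS (q * 2) (r * 2) (blowup r V)
blowup-isIFS q r V = record
  { hole-empty   = λ i j (i< , j<) →
      entry-in-hole (odd (toℕ i)) (odd (toℕ j)) (V ⌊ toℕ i /2⌋ ⌊ toℕ j /2⌋)
                    (hole-complete (halve i i<) (halve j j<))
  ; filled       = λ i j ¬inHole cell≡nothing →
      let (I< , J<) = hole-sound (entry≡nothing⇒hole _ (odd (toℕ i)) (odd (toℕ j)) (V _ _)
                                                     cell≡nothing)
      in ¬inHole (⌊m/2⌋<n⇒m<n*2 (toℕ i) r I< , ⌊m/2⌋<n⇒m<n*2 (toℕ j) r J<)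
  ; row-balanced = λ i → let I = ⌊ toℕ i /2⌋ in
      count-by-pairs q
        (λ J p → has (entry (hole r I J) (odd (toℕ i)) p (V I J)) false)
        (λ J p → has (entry (hole r I J) (odd (toℕ i)) p (V I J)) true)
        (λ J → entry-row-balanced (hole r I J) (odd (toℕ i)) (V I J))
  ; col-balanced = λ j → let J = ⌊ toℕ j /2⌋ in
      count-by-pairs q
        (λ I p → has (entry (hole r I J) p (odd (toℕ j)) (V I J)) false)
        (λ I p → has (entry (hole r I J) p (odd (toℕ j)) (V I J)) true)
        (λ I → entry-col-balanced (hole r I J) (odd (toℕ j)) (V I J))
  }
  where
  halve : ∀ {n} (i : Fin n) → toℕ i < r * 2 → ⌊ toℕ i /2⌋ < r
  halve i = m<n*2⇒⌊m/2⌋<n (toℕ i) r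

countGrid : ℕ → (ℕ → ℕ → Bool) → ℕ
countGrid q P = sumTo q (λ I → countTo q (P I))

module Superposition (q r : ℕ) (V W : ℕ → ℕ → Bool) where

  agreeing : Bool → ℕ
  agreeing d = countGrid q (λ I J → not (hole r I J) ∧ (d xor (V I J xor W I J)))

  pairCount-blowup : ∀ a c → pairCount {q * 2} (blowup r V) (blowup r W) a c ≡
                             agreeing (not (a xor c)) + agreeing (not (a xor c))
  pairCount-blowup a c = begin
    pairCount {q * 2} (blowup r V) (blowup r W) a c
      ≡⟨ sumF-cong {q * 2} (λ i → sumF-toℕ (q * 2) (Q (toℕ i))) ⟩
    sumF {q * 2} (λ i → sumTo (q * 2) (Q (toℕ i)))
      ≡⟨ sumF-toℕ (q * 2) (λ i → sumTo (q * 2) (Q i)) ⟩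
    sumTo (q * 2) (λ i → sumTo (q * 2) (Q i))
      ≡⟨ sum-cong (q * 2) (λ i → sum-pairs q (B ⌊ i /2⌋ (odd i))) ⟩
    sumTo (q * 2) (λ i → sumTo q (λ J → B ⌊ i /2⌋ (odd i) J false + B ⌊ i /2⌋ (odd i) J true))
      ≡⟨ sum-pairs q (λ I p → sumTo q (λ J → B I p J false + B I p J true)) ⟩
    sumTo q (λ I → sumTo q (λ J → B I false J false + B I false J true)
                 + sumTo q (λ J → B I true J false + B I true J true))
      ≡⟨ sum-cong q (λ I → sym (sum-distrib-+ q _ _)) ⟩
    sumTo q (λ I → sumTo q (λ J → (B I false J false + B I false J true)
                                 + (B I true J false + B I true J true)))
      ≡⟨ sum-cong q (λ I → sum-cong q (λ J →
           entry-superimposed (hole r I J) (V I J) (W I J) a c)) ⟩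
    sumTo q (λ I → sumTo q (λ J → e I J + e I J))
      ≡⟨ sum-cong q (λ I → sum-distrib-+ q (e I) (e I)) ⟩
    sumTo q (λ I → countTo q (P I) + countTo q (P I))
      ≡⟨ sum-distrib-+ q _ _ ⟩
    agreeing (not (a xor c)) + agreeing (not (a xor c)) ∎
    where
    open ≡-Reasoning
    Q : ℕ → ℕ → ℕ
    Q i j = ind (has (cell r V i j) a ∧ has (cell r W i j) c)
    B : ℕ → Bool → ℕ → Bool → ℕ
    B I p₁ J p₂ = ind (has (entry (hole r I J) p₁ p₂ (V I J)) a ∧
                       has (entry (hole r I J) p₁ p₂ (W I J)) c)
    P : ℕ → ℕ → Bool
    P I J = not (hole r I J) ∧ (not (a xor c) xor (V I J xor W I J))
    e : ℕ → ℕ → ℕ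
    e I J = ind (P I J)

  blowup-orthogonal : agreeing false ≡ agreeing true → Orthogonal {q * 2} (blowup r V) (blowup r W)
  blowup-orthogonal agree a c a′ c′ = begin
    pairCount {q * 2} (blowup r V) (blowup r W) a c ≡⟨ pairCount-blowup a c ⟩
    agreeing d + agreeing d                  ≡⟨ cong (λ s → s + s) (agreeing-constant d d′) ⟩
    agreeing d′ + agreeing d′                ≡⟨ sym (pairCount-blowup a′ c′) ⟩
    pairCount {q * 2} (blowup r V) (blowup r W) a′ c′ ∎
    where
    open ≡-Reasoning
    d  = not (a xor c)
    d′ = not (a′ xor c′)
    agreeing-constant : ∀ d d′ → agreeing d ≡ agreeing d′
    agreeing-constant false false = refl
    agreeing-constant false true  = agree
    agreeing-constant true  false = sym agree
    agreeing-constant true  true  = refl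

-- Numbers the cells outside the hole by [0, r b + b (r + b)): first the r × b cells right of
-- the hole, then the b full rows below it.
label : ℕ → ℕ → ℕ → ℕ → ℕ
label r b I J = if I <ᵇ r then I * b + (J ∸ r) else r * b + ((I ∸ r) * (r + b) + J)

countGrid-label : ∀ r b (p : ℕ → Bool) →
  countGrid (r + b) (λ I J → not (hole r I J) ∧ p (label r b I J)) ≡ countTo (r * b + b * (r + b)) p
countGrid-label r b p = begin
  countGrid q P
    ≡⟨ sum-++ r b (λ I → countTo q (P I)) ⟩
  sumTo r (λ I → countTo q (P I)) + sumTo b (λ I′ → countTo q (P (r + I′)))
    ≡⟨ cong₂ _+_ (sum-cong< r row-beside) (sum-cong b row-below) ⟩
  sumTo r (λ I → countTo b (λ k → p (I * b + k)))
    + sumTo b (λ I′ → countTo q (λ J → p (r * b + (I′ * q + J))))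
    ≡⟨ sym (cong₂ _+_ (sum-blocks r b (ind ∘ p)) (sum-blocks b q (ind ∘ p ∘ (r * b +_)))) ⟩
  countTo (r * b) p + countTo (b * q) (p ∘ (r * b +_))
    ≡⟨ sym (sum-++ (r * b) (b * q) (ind ∘ p)) ⟩
  countTo (r * b + b * q) p ∎
  where
  open ≡-Reasoning
  q = r + b
  P : ℕ → ℕ → Bool
  P I J = not (hole r I J) ∧ p (label r b I J)
  row-beside : ∀ I → I < r → countTo q (P I) ≡ countTo b (λ k → p (I * b + k))
  row-beside I I<r = begin
    countTo q (P I)
      ≡⟨ sum-++ r b (ind ∘ P I) ⟩
    countTo r (P I) + countTo b (P I ∘ (r +_))
      ≡⟨ cong₂ _+_ (trans (sum-cong< r in-hole) (sum-zero r)) (sum-cong b beside-hole) ⟩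
    0 + countTo b (λ k → p (I * b + k)) ∎
    where
    in-hole : ∀ J → J < r → ind (P I J) ≡ 0
    in-hole J J<r rewrite Equivalence.to T-≡ (hole-complete {r} I<r J<r) = refl
    beside-hole : ∀ k → ind (P I (r + k)) ≡ ind (p (I * b + k))
    beside-hole k rewrite <ᵇ-true I<r | m+n<ᵇm≡false r k | m+n∸m≡n r k = refl
  row-below : ∀ I′ → countTo q (P (r + I′)) ≡ countTo q (λ J → p (r * b + (I′ * q + J)))
  row-below I′ = sum-cong q λ J → cong ind (below-hole J)
    where
    below-hole : ∀ J → P (r + I′) J ≡ p (r * b + (I′ * q + J))
    below-hole J rewrite m+n<ᵇm≡false r I′ | m+n∸m≡n r I′ = refl

imofs-bordered : ∀ r b β → 2 ^ β ∣ r * b + b * (r + b) → IMOFS (2 ^ β ∸ 1) ((r + b) * 2) (r * 2)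
imofs-bordered r b β (divides m cells≡) = square , (λ x → blowup-isIFS (r + b) r (V x)) , orthogonal
  where
  open Superposition using (blowup-orthogonal)
  V : Fin (2 ^ β ∸ 1) → ℕ → ℕ → Bool
  V x I J = χ β (toℕ x) (label r b I J)
  square : Fin (2 ^ β ∸ 1) → Array ((r + b) * 2)
  square x = blowup r (V x)
  character< : (x : Fin (2 ^ β ∸ 1)) → toℕ x < 2 ^ β
  character< x = <-≤-trans (toℕ<n x) (m∸n≤m (2 ^ β) 1)
  orthogonal : ∀ x y → x ≢ y → Orthogonal (square x) (square y)
  orthogonal x y x≢y = blowup-orthogonal (r + b) r (V x) (V y) (begin
    agreeing false                          ≡⟨ countGrid-label r b p ⟩
    countTo (r * b + b * (r + b)) p         ≡⟨ cong (λ n → countTo n p) cells≡ ⟩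
    countTo (m * 2 ^ β) p                   ≡⟨ walsh-balanced β m (character< x) (character< y)
                                                                (x≢y ∘ toℕ-injective) ⟩
    countTo (m * 2 ^ β) (not ∘ p)           ≡⟨ cong (λ n → countTo n (not ∘ p)) (sym cells≡) ⟩
    countTo (r * b + b * (r + b)) (not ∘ p) ≡⟨ sym (countGrid-label r b (not ∘ p)) ⟩
    agreeing true                           ∎)
    where
    open ≡-Reasoning
    agreeing = Superposition.agreeing (r + b) r (V x) (V y)
    p : ℕ → Bool
    p k = χ β (toℕ x) k xor χ β (toℕ y) k

border-hole-side : ∀ r b → (r + b) * 2 ∸ 2 * b ≡ r * 2
border-hole-side r b = trans (cong (_∸ 2 * b) (double r b)) (m+n∸n≡m (r * 2) (2 * b))
  where
  double : ∀ r b → (r + b) * 2 ≡ r * 2 + 2 * b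
  double = solve-∀

border-cells : ∀ r b → b * ((r + b) * 2 ∸ b) ≡ r * b + b * (r + b)
border-cells r b = begin
  b * ((r + b) * 2 ∸ b)       ≡⟨ cong (λ t → b * (t ∸ b)) (double r b) ⟩
  b * ((r + (r + b)) + b ∸ b) ≡⟨ cong (b *_) (m+n∸n≡m (r + (r + b)) b) ⟩
  b * (r + (r + b))           ≡⟨ area r b ⟩
  r * b + b * (r + b)         ∎
  where
  open ≡-Reasoning
  double : ∀ r b → (r + b) * 2 ≡ (r + (r + b)) + b
  double = solve-∀
  area : ∀ r b → b * (r + (r + b)) ≡ r * b + b * (r + b)
  area = solve-∀

corollary6p7 : (n b β : ℕ) → 2 ∣ n → 0 < n → 0 < b → 2 * b < n →
               2 ^ β ∣ b * (n ∸ b) →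
               IMOFS (2 ^ β ∸ 1) n (n ∸ 2 * b)
corollary6p7 _ b β (divides q refl) _ _ 2b<n 2^β∣area =
  subst (λ q → 2 ^ β ∣ b * (q * 2 ∸ b) → IMOFS (2 ^ β ∸ 1) (q * 2) (q * 2 ∸ 2 * b))
        (m∸n+n≡m b≤q) bordered 2^β∣area
  where
  b≤q : b ≤ q
  b≤q = <⇒≤ (*-cancelʳ-< 2 b q (subst (_< q * 2) (*-comm 2 b) 2b<n))
  r = q ∸ b
  bordered : 2 ^ β ∣ b * ((r + b) * 2 ∸ b) → IMOFS (2 ^ β ∸ 1) ((r + b) * 2) ((r + b) * 2 ∸ 2 * b)
  bordered 2^β∣ = subst (IMOFS (2 ^ β ∸ 1) ((r + b) * 2)) (sym (border-hole-side r b))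
                        (imofs-bordered r b β (subst (2 ^ β ∣_) (border-cells r b) 2^β∣))
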